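{- The following equation holds as a formal power series in $\mathbb{Z}[\![p,q]\!]$: \begin{align*} \sum_{n, \ell \ge 0} (F_{k,n}(j), F_{k,\ell}(j))\, p^{n-m}q^{\ell -m} = \frac{\sum_{n, \ell \ge 0} (F_{0,n}(j), F_{0,\ell}(j))\, p^{n}q^{\ell}}{(E_{4}(p)E_{4}(q))^{\delta} (E_{6}(p)E_{6}(q))^{\varepsilon} (\Delta (p)\Delta (q))^{m}} . \end{align*}
   Context: Let $E_2,E_4,E_6$ be the normalized Eisenstein series on $SL_2(\mathbb{Z})$, $\Delta=(E_4^3-E_6^2)/1728$, $j=E_4^3/\Delta$. The Atkin inner product on $\mathbb{C}[j]$ is $(f,g)=$ constant term of $fgE_2$ as a Laurent series in $q$. Write the even integer $k=12m+4\delta+6\varepsilon$ with uniquely determined $m\in\mathbb{Z}$, $\delta\in\{0,1,2\}$, $\varepsilon\in\{0,1\}$. The generalized Faber polynomial $F_{k,n}(X)$ is the monic polynomial of degree $n$ such that, for each integer $\ell\ge -m$, $E_4^{\delta}E_6^{\varepsilon}\Delta^{m}F_{k,\ell+m}(j)$ is the unique weakly holomorphic modular form of weight $k$ on $SL_2(\mathbb{Z})$ with Fourier expansion $q^{ -\ell}+O(q^{m+1})$. -}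

module Defs where

open import Data.Bool using (Bool; true; false; if_then_else_)
open import Data.Nat as ℕ using (ℕ; zero; suc)
open import Data.Nat.Divisibility using (_∣?_)
open import Data.Integer as ℤ using (ℤ; +_; -[1+_]; _+_; _*_; -_; _-_; _⊓_; ∣_∣; 0ℤ; 1ℤ)
open import Data.Integer.DivMod using (_/ℕ_)
open import Data.Fin using (Fin; toℕ)
open import Data.Vec using (Vec; []; _∷_; head; tabulate; zipWith; foldr; toList)
open import Data.List using (List; []; _∷_; _++_)
open import Relation.Nullary using (does)

PS : Set
PS = ℕ → ℤ

sumTo : (ℕ → ℤ) → ℕ → ℤ
sumTo h zero    = h zero
sumTo h (suc n) = sumTo h n + h (suc n)

constPS : ℤ → PS
constPS c zero    = c
constPS c (suc _) = 0ℤ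

onePS : PS
onePS = constPS 1ℤ

_+ₛ_ : PS → PS → PS
(f +ₛ g) n = f n + g n

_-ₛ_ : PS → PS → PS
(f -ₛ g) n = f n - g n

_⊛_ : PS → PS → PS
(f ⊛ g) n = sumTo (λ i → f i * g (n ℕ.∸ i)) n

infixl 7 _⊛_
infixl 6 _+ₛ_ _-ₛ_

_^ₛ_ : PS → ℕ → PS
f ^ₛ zero  = onePS
f ^ₛ suc n = f ⊛ (f ^ₛ n)

shiftPS : ℕ → PS → PS
shiftPS s f n = if n ℕ.<ᵇ s then 0ℤ else f (n ℕ.∸ s)

-- Multiplicative inverse of a power series with constant term 1.
-- invVec f n = [g_n , g_(n-1) , ... , g_0] where g = f⁻¹, computed by
-- g_0 = 1,  g_(n+1) = - Σ_{i=1}^{n+1} f_i g_(n+1-i).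
invVec : PS → (n : ℕ) → Vec ℤ (suc n)
invVec f zero    = 1ℤ ∷ []
invVec f (suc n) =
  let v = invVec f n in
  - foldr _ _+_ 0ℤ (zipWith _*_ (tabulate (λ t → f (suc (toℕ t)))) v) ∷ v

invPS : PS → PS
invPS f n = head (invVec f n)

-- integer powers of a unit power series (constant term 1)
_^ᶻ_ : PS → ℤ → PS
f ^ᶻ (+ n)    = f ^ₛ n
f ^ᶻ -[1+ n ] = invPS f ^ₛ suc n

σ : ℕ → ℕ → ℕ
σ r n = go n
  where
  go : ℕ → ℕ
  go zero    = 0
  go (suc d) = go d ℕ.+ (if does (suc d ∣? n) then suc d ℕ.^ r else 0)

E2 : PS
E2 zero    = 1ℤ
E2 (suc n) = - (+ 24 * + σ 1 (suc n))

E4 : PS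
E4 zero    = 1ℤ
E4 (suc n) = + 240 * + σ 3 (suc n)

E6 : PS
E6 zero    = 1ℤ
E6 (suc n) = - (+ 504 * + σ 5 (suc n))

-- Δ = (E4^3 - E6^2)/1728 (coefficientwise exact integer division)
Δ : PS
Δ n = ((E4 ^ₛ 3 -ₛ E6 ^ₛ 2) n) /ℕ 1728

-- Δ / q  (a power series with constant term 1)
Δ/q : PS
Δ/q n = Δ (suc n)

-- Laurent series q^val · ser with ser ∈ ℤ[[q]]

record Laurent : Set where
  constructor ⟨_,_⟩
  field
    val : ℤ
    ser : PS
open Laurent public

coeff : Laurent → ℤ → ℤ
coeff L e with e - val L
... | + k      = ser L k
... | -[1+ _ ] = 0ℤ

_+L_ : Laurent → Laurent → Laurent
⟨ v₁ , s₁ ⟩ +L ⟨ v₂ , s₂ ⟩ =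
  let v = v₁ ⊓ v₂ in
  ⟨ v , shiftPS (∣ v₁ - v ∣) s₁ +ₛ shiftPS (∣ v₂ - v ∣) s₂ ⟩

_*L_ : Laurent → Laurent → Laurent
⟨ v₁ , s₁ ⟩ *L ⟨ v₂ , s₂ ⟩ = ⟨ v₁ + v₂ , s₁ ⊛ s₂ ⟩

infixl 7 _*L_
infixl 6 _+L_

constL : ℤ → Laurent
constL c = ⟨ 0ℤ , constPS c ⟩

_^L_ : Laurent → ℕ → Laurent
L ^L zero  = constL 1ℤ
L ^L suc n = L *L (L ^L n)

E2L E4L E6L ΔL : Laurent
E2L = ⟨ 0ℤ , E2 ⟩
E4L = ⟨ 0ℤ , E4 ⟩
E6L = ⟨ 0ℤ , E6 ⟩
ΔL  = ⟨ 1ℤ , Δ/q ⟩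

-- Δ^m for m ∈ ℤ:  q^m (Δ/q)^m
ΔL^ : ℤ → Laurent
ΔL^ m = ⟨ m , Δ/q ^ᶻ m ⟩

-- j = E4^3 / Δ = q^(-1) · E4^3 · (Δ/q)^(-1)
jL : Laurent
jL = ⟨ - 1ℤ , E4 ^ₛ 3 ⊛ invPS Δ/q ⟩

-- evaluate a polynomial (ascending coefficient list) at a Laurent series
evalPoly : List ℤ → Laurent → Laurent
evalPoly []       x = constL 0ℤ
evalPoly (c ∷ cs) x = constL c +L x *L evalPoly cs x

-- monic polynomial of degree n: lower coefficients c_0 … c_(n-1), leading 1
Monic : ℕ → Set
Monic n = Vec ℤ n

monicCoeffs : ∀ {n} → Monic n → List ℤ
monicCoeffs c = toList c ++ (1ℤ ∷ [])

atJ : ∀ {n} → Monic n → Laurent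
atJ P = evalPoly (monicCoeffs P) jL

-- (f , g) = constant term of f g E2
atkin : Laurent → Laurent → ℤ
atkin f g = coeff (f *L g *L E2L) 0ℤ

weight : ℤ → Fin 3 → Fin 2 → ℤ
weight m δ ε = + 12 * m + + 4 * + toℕ δ + + 6 * + toℕ ε

baseForm : ℤ → Fin 3 → Fin 2 → Laurent
baseForm m δ ε = (E4L ^L toℕ δ) *L (E6L ^L toℕ ε) *L ΔL^ m

-- P is the generalized Faber polynomial F_{k,n} for k = 12m+4δ+6ε:
-- E4^δ E6^ε Δ^m P(j) = q^(-ℓ) + O(q^(m+1)) where ℓ = n - m.
IsFaber : (m : ℤ) (δ : Fin 3) (ε : Fin 2) (n : ℕ) → Monic n → Set
IsFaber m δ ε n P =
  ∀ (e : ℤ) → e ℤ.≤ m →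
    coeff (baseForm m δ ε *L atJ P) e
      ≡ (if does (e ℤ.≟ m - + n) then 1ℤ else 0ℤ)
  where open import Relation.Binary.PropositionalEquality using (_≡_)

-- H = E4^δ E6^ε (Δ/q)^m, so that E4^δ E6^ε Δ^m = q^m H (as series in q)
unitFactor : ℤ → Fin 3 → Fin 2 → PS
unitFactor m δ ε = (E4 ^ₛ toℕ δ) ⊛ (E6 ^ₛ toℕ ε) ⊛ (Δ/q ^ᶻ m)

PS₂ : Set
PS₂ = ℕ → ℕ → ℤ   -- coefficient of p^N q^L

-- (g(p) h(q) · b)(p,q)
mulPQ : PS → PS → PS₂ → PS₂
mulPQ g h b N L =
  sumTo (λ n → sumTo (λ ℓ → b n ℓ * g (N ℕ.∸ n) * h (L ℕ.∸ ℓ)) L) N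

{-# OPTIONS --safe #-}

-- Write H = E4^δ E6^ε (Δ/q)^m, so that E4^δ E6^ε Δ^m = q^m H with H(0) = 1, and let u = 1/H.
-- Multiplying by the unit H, the Faber condition says that F_{k,N}(j) agrees with q^(-N) u at
-- every exponent ≤ 0, while F_{0,n}(j) agrees with q^(-n) there. A polynomial in j = q^(-1) + O(1)
-- with no coefficients at exponents ≤ 0 is zero, hence F_{k,N}(j) = Σ_{n ≤ N} u_(N-n) F_{0,n}(j).
-- Bilinearity of the Atkin product then gives
-- (F_{k,N}, F_{k,L}) = Σ_{n ≤ N, ℓ ≤ L} u_(N-n) u_(L-ℓ) (F_{0,n}, F_{0,ℓ}),
-- which is the coefficient of p^N q^L on the right-hand side.

module Submission where

open import Defs
open import Data.Nat using (ℕ)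
open import Data.Integer using (ℤ; 0ℤ)
open import Data.Fin using (Fin; zero)
open import Relation.Binary.PropositionalEquality using (_≡_)

open import Data.Bool using (if_then_else_)
open import Data.Empty using (⊥-elim)
open import Data.Fin as Fin using (toℕ)
open import Data.Integer as ℤ using (+_; -[1+_]; _+_; _*_; -_; _-_; _⊓_; ∣_∣; 1ℤ; +<+)
open import Data.Integer.Solver using (module +-*-Solver)
import Data.Integer.Properties as ℤP
open import Algebra.Bundles using (AbelianGroup)
open import Algebra.Properties.Group (AbelianGroup.group ℤP.+-0-abelianGroup) using (∙-cancelʳ)
open import Algebra.Properties.CommutativeSemigroup ℤP.+-commutativeSemigroup
  using () renaming (interchange to +-interchange)
open import Data.List using (List; []; _∷_)
open import Data.Nat as ℕ using (suc; z≤n; s≤s; _∸_)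
import Data.Nat.Properties as ℕP
open import Data.Sum using (inj₁; inj₂)
open import Data.Vec using (Vec; []; _∷_; lookup; tabulate; zipWith; foldr)
open import Function using (_∘_)
open import Relation.Binary.PropositionalEquality
  using (_≗_; _≢_; refl; sym; trans; cong; cong₂; subst; module ≡-Reasoning)
open import Relation.Nullary using (does; yes; no)

open +-*-Solver using (solve; _:+_; _:*_; :-_; _:=_; con)

-- Finite sums

sumTo-cong : ∀ {h k : ℕ → ℤ} n → (∀ i → i ℕ.≤ n → h i ≡ k i) → sumTo h n ≡ sumTo k n
sumTo-cong 0       eq = eq 0 z≤n
sumTo-cong (suc n) eq =
  cong₂ _+_ (sumTo-cong n (λ i i≤n → eq i (ℕP.m≤n⇒m≤1+n i≤n))) (eq (suc n) ℕP.≤-refl)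

sumTo-zero : ∀ {h : ℕ → ℤ} n → (∀ i → i ℕ.≤ n → h i ≡ 0ℤ) → sumTo h n ≡ 0ℤ
sumTo-zero 0       eq = eq 0 z≤n
sumTo-zero (suc n) eq =
  cong₂ _+_ (sumTo-zero n (λ i i≤n → eq i (ℕP.m≤n⇒m≤1+n i≤n))) (eq (suc n) ℕP.≤-refl)

sumTo-suc : ∀ (h : ℕ → ℤ) n → sumTo h (suc n) ≡ h 0 + sumTo (h ∘ suc) n
sumTo-suc h 0       = refl
sumTo-suc h (suc n) =
  trans (cong (_+ h (suc (suc n))) (sumTo-suc h n)) (ℤP.+-assoc (h 0) _ (h (suc (suc n))))

sumTo-+ : ∀ (h k : ℕ → ℤ) n → sumTo (λ i → h i + k i) n ≡ sumTo h n + sumTo k n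
sumTo-+ h k 0       = refl
sumTo-+ h k (suc n) =
  trans (cong (_+ (h (suc n) + k (suc n))) (sumTo-+ h k n))
        (+-interchange (sumTo h n) (sumTo k n) (h (suc n)) (k (suc n)))

*-distribˡ-sumTo : ∀ a (h : ℕ → ℤ) n → a * sumTo h n ≡ sumTo (λ i → a * h i) n
*-distribˡ-sumTo a h 0       = refl
*-distribˡ-sumTo a h (suc n) =
  trans (ℤP.*-distribˡ-+ a (sumTo h n) (h (suc n))) (cong (_+ a * h (suc n)) (*-distribˡ-sumTo a h n))

sumTo-reverse : ∀ (h : ℕ → ℤ) n → sumTo h n ≡ sumTo (λ i → h (n ∸ i)) n
sumTo-reverse h 0       = refl
sumTo-reverse h (suc n) = begin
  sumTo h (suc n)                       ≡⟨ sumTo-suc h n ⟩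
  h 0 + sumTo (h ∘ suc) n               ≡⟨ cong (_+_ (h 0)) (sumTo-reverse (h ∘ suc) n) ⟩
  h 0 + sumTo (λ i → h (suc (n ∸ i))) n
    ≡⟨ cong (_+_ (h 0)) (sumTo-cong n (λ i i≤n → cong h (sym (ℕP.+-∸-assoc 1 i≤n)))) ⟩
  h 0 + sumTo (λ i → h (suc n ∸ i)) n   ≡⟨ ℤP.+-comm (h 0) _ ⟩
  sumTo (λ i → h (suc n ∸ i)) n + h 0   ≡⟨ cong (λ j → sumTo (λ i → h (suc n ∸ i)) n + h j) (sym (ℕP.n∸n≡0 n)) ⟩
  sumTo (λ i → h (suc n ∸ i)) (suc n)   ∎
  where open ≡-Reasoning

sumTo-dropZeros : ∀ d k (h : ℕ → ℤ) → (∀ i → i ℕ.< d → h i ≡ 0ℤ) →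
                  sumTo h (d ℕ.+ k) ≡ sumTo (λ i → h (d ℕ.+ i)) k
sumTo-dropZeros 0       k h _     = refl
sumTo-dropZeros (suc d) k h zeros = begin
  sumTo h (suc (d ℕ.+ k))                     ≡⟨ sumTo-suc h (d ℕ.+ k) ⟩
  h 0 + sumTo (h ∘ suc) (d ℕ.+ k)
    ≡⟨ cong₂ _+_ (zeros 0 (s≤s z≤n)) (sumTo-dropZeros d k (h ∘ suc) (λ i i<d → zeros (suc i) (s≤s i<d))) ⟩
  0ℤ + sumTo (λ i → h (suc (d ℕ.+ i))) k      ≡⟨ ℤP.+-identityˡ _ ⟩
  sumTo (λ i → h (suc d ℕ.+ i)) k             ∎
  where open ≡-Reasoning

sumTo-select : ∀ (h d : ℕ → ℤ) {k} → d k ≡ 1ℤ → (∀ n → n ≢ k → d n ≡ 0ℤ) →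
               ∀ K → k ℕ.≤ K → sumTo (λ n → h n * d n) K ≡ h k
sumTo-select h d {k} dk≡1 dn≡0 = select
  where
  vanish : ∀ n → n ≢ k → h n * d n ≡ 0ℤ
  vanish n n≢k = trans (cong (h n *_) (dn≡0 n n≢k)) (ℤP.*-zeroʳ (h n))
  select : ∀ K → k ℕ.≤ K → sumTo (λ n → h n * d n) K ≡ h k
  select 0       z≤n   = trans (cong (h 0 *_) dk≡1) (ℤP.*-identityʳ (h 0))
  select (suc K) k≤1+K with ℕP.m≤n⇒m<n∨m≡n k≤1+K
  ... | inj₁ (s≤s k≤K) =
    trans (cong₂ _+_ (select K k≤K) (vanish (suc K) (λ { refl → ℕP.<-irrefl refl k≤K })))
          (ℤP.+-identityʳ (h k))
  ... | inj₂ refl      =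
    trans (cong₂ _+_ (sumTo-zero K (λ n n≤K → vanish n (λ { refl → ℕP.<-irrefl refl n≤K })))
                     (cong (h k *_) dk≡1))
          (trans (ℤP.+-identityˡ _) (ℤP.*-identityʳ (h k)))

-- Power series

⊛-comm : ∀ f g → f ⊛ g ≗ g ⊛ f
⊛-comm f g n = trans (sumTo-reverse (λ i → f i * g (n ∸ i)) n)
  (sumTo-cong n (λ i i≤n → trans (cong (λ j → f (n ∸ i) * g j) (ℕP.m∸[m∸n]≡n i≤n))
                                 (ℤP.*-comm (f (n ∸ i)) (g i))))

⊛-congˡ : ∀ {f f′} g → f ≗ f′ → f ⊛ g ≗ f′ ⊛ g
⊛-congˡ g eq n = sumTo-cong n (λ i _ → cong (_* g (n ∸ i)) (eq i))

⊛-congʳ : ∀ f {g g′} → g ≗ g′ → f ⊛ g ≗ f ⊛ g′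
⊛-congʳ f eq n = sumTo-cong n (λ i _ → cong (f i *_) (eq (n ∸ i)))

⊛-linearˡ : ∀ a b f f′ g →
            (λ i → a * f i + b * f′ i) ⊛ g ≗ λ n → a * (f ⊛ g) n + b * (f′ ⊛ g) n
⊛-linearˡ a b f f′ g n = begin
  sumTo (λ i → (a * f i + b * f′ i) * g (n ∸ i)) n
    ≡⟨ sumTo-cong n (λ i _ → distrib (f i) (f′ i) (g (n ∸ i))) ⟩
  sumTo (λ i → a * (f i * g (n ∸ i)) + b * (f′ i * g (n ∸ i))) n
    ≡⟨ sumTo-+ _ _ n ⟩
  sumTo (λ i → a * (f i * g (n ∸ i))) n + sumTo (λ i → b * (f′ i * g (n ∸ i))) n
    ≡⟨ sym (cong₂ _+_ (*-distribˡ-sumTo a _ n) (*-distribˡ-sumTo b _ n)) ⟩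
  a * (f ⊛ g) n + b * (f′ ⊛ g) n ∎
  where
  open ≡-Reasoning
  distrib : ∀ x y z → (a * x + b * y) * z ≡ a * (x * z) + b * (y * z)
  distrib = solve 5 (λ a b x y z → (a :* x :+ b :* y) :* z := a :* (x :* z) :+ b :* (y :* z)) refl a b

⊛-suc : ∀ f g n → (f ⊛ g) (suc n) ≡ f 0 * g (suc n) + sumTo (λ i → f (suc i) * g (n ∸ i)) n
⊛-suc f g n = sumTo-suc (λ i → f i * g (suc n ∸ i)) n

⊛-identityˡ : ∀ f → onePS ⊛ f ≗ f
⊛-identityˡ f 0       = ℤP.*-identityˡ (f 0)
⊛-identityˡ f (suc n) = begin
  (onePS ⊛ f) (suc n)                         ≡⟨ ⊛-suc onePS f n ⟩
  1ℤ * f (suc n) + sumTo (λ i → 0ℤ * f (n ∸ i)) n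
    ≡⟨ cong₂ _+_ (ℤP.*-identityˡ (f (suc n))) (sumTo-zero n (λ i _ → ℤP.*-zeroˡ (f (n ∸ i)))) ⟩
  f (suc n) + 0ℤ                              ≡⟨ ℤP.+-identityʳ _ ⟩
  f (suc n)                                   ∎
  where open ≡-Reasoning

⊛-identityʳ : ∀ f → f ⊛ onePS ≗ f
⊛-identityʳ f n = trans (⊛-comm f onePS n) (⊛-identityˡ f n)

data Cut (d : ℕ) : ℕ → Set where
  lo : ∀ {i} → i ℕ.< d → Cut d i
  hi : ∀ k → Cut d (d ℕ.+ k)

cut : ∀ d i → Cut d i
cut d i with i ℕ.<? d
... | yes i<d = lo i<d
... | no  i≮d = subst (Cut d) (ℕP.m+[n∸m]≡n (ℕP.≮⇒≥ i≮d)) (hi (i ∸ d))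

shiftPS-lo : ∀ d s {i} → i ℕ.< d → shiftPS d s i ≡ 0ℤ
shiftPS-lo (suc d) s {0}     _         = refl
shiftPS-lo (suc d) s {suc i} (s≤s i<d) = shiftPS-lo d s i<d

shiftPS-hi : ∀ d s k → shiftPS d s (d ℕ.+ k) ≡ s k
shiftPS-hi 0       s k = refl
shiftPS-hi (suc d) s k = shiftPS-hi d s k

shiftPS-cong : ∀ d {s s′} → s ≗ s′ → shiftPS d s ≗ shiftPS d s′
shiftPS-cong d {s} {s′} eq i with cut d i
... | lo i<d = trans (shiftPS-lo d s i<d) (sym (shiftPS-lo d s′ i<d))
... | hi k   = trans (shiftPS-hi d s k) (trans (eq k) (sym (shiftPS-hi d s′ k)))

shiftPS-+ : ∀ a b s → shiftPS a (shiftPS b s) ≗ shiftPS (a ℕ.+ b) s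
shiftPS-+ a b s i with cut a i
... | lo i<a = trans (shiftPS-lo a (shiftPS b s) i<a)
                     (sym (shiftPS-lo (a ℕ.+ b) s (ℕP.<-≤-trans i<a (ℕP.m≤m+n a b))))
... | hi k with cut b k
...   | lo k<b = trans (shiftPS-hi a (shiftPS b s) k)
                  (trans (shiftPS-lo b s k<b) (sym (shiftPS-lo (a ℕ.+ b) s (ℕP.+-monoʳ-< a k<b))))
...   | hi l   = trans (shiftPS-hi a (shiftPS b s) (b ℕ.+ l))
                  (trans (shiftPS-hi b s l)
                  (sym (trans (cong (shiftPS (a ℕ.+ b) s) (sym (ℕP.+-assoc a b l)))
                              (shiftPS-hi (a ℕ.+ b) s l))))

shiftPS-⊛ˡ : ∀ d s r → shiftPS d s ⊛ r ≗ shiftPS d (s ⊛ r)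
shiftPS-⊛ˡ d s r i with cut d i
... | lo i<d = trans (sumTo-zero i (λ a a≤i → cong (_* r (i ∸ a))
                                                    (shiftPS-lo d s (ℕP.≤-<-trans a≤i i<d))))
                     (sym (shiftPS-lo d (s ⊛ r) i<d))
... | hi k   = begin
  sumTo (λ a → shiftPS d s a * r (d ℕ.+ k ∸ a)) (d ℕ.+ k)
    ≡⟨ sumTo-dropZeros d k _ (λ a a<d → cong (_* r (d ℕ.+ k ∸ a)) (shiftPS-lo d s a<d)) ⟩
  sumTo (λ a → shiftPS d s (d ℕ.+ a) * r (d ℕ.+ k ∸ (d ℕ.+ a))) k
    ≡⟨ sumTo-cong k (λ a _ → cong₂ _*_ (shiftPS-hi d s a) (cong r (ℕP.[m+n]∸[m+o]≡n∸o d k a))) ⟩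
  (s ⊛ r) k                                   ≡⟨ sym (shiftPS-hi d (s ⊛ r) k) ⟩
  shiftPS d (s ⊛ r) (d ℕ.+ k)                 ∎
  where open ≡-Reasoning

shiftPS-⊛ʳ : ∀ d r s → r ⊛ shiftPS d s ≗ shiftPS d (r ⊛ s)
shiftPS-⊛ʳ d r s i =
  trans (⊛-comm r (shiftPS d s) i) (trans (shiftPS-⊛ˡ d s r i) (shiftPS-cong d (⊛-comm s r) i))

invVec-lookup : ∀ f n (t : Fin (suc n)) → lookup (invVec f n) t ≡ invPS f (n ∸ toℕ t)
invVec-lookup f 0       zero        = refl
invVec-lookup f (suc n) zero        = refl
invVec-lookup f (suc n) (Fin.suc t) = invVec-lookup f n t

foldr-zipWith-tabulate : ∀ n (a g : ℕ → ℤ) (v : Vec ℤ (suc n)) →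
  (∀ t → lookup v t ≡ g (n ∸ toℕ t)) →
  foldr _ _+_ 0ℤ (zipWith _*_ (tabulate (a ∘ toℕ)) v) ≡ sumTo (λ i → a i * g (n ∸ i)) n
foldr-zipWith-tabulate 0       a g (x ∷ []) v≡g =
  trans (ℤP.+-identityʳ (a 0 * x)) (cong (a 0 *_) (v≡g zero))
foldr-zipWith-tabulate (suc n) a g (x ∷ v) v≡g =
  trans (cong₂ _+_ (cong (a 0 *_) (v≡g zero)) (foldr-zipWith-tabulate n (a ∘ suc) g v (v≡g ∘ Fin.suc)))
        (sym (sumTo-suc (λ i → a i * g (suc n ∸ i)) n))

⊛-invPS : ∀ f → f 0 ≡ 1ℤ → f ⊛ invPS f ≗ onePS
⊛-invPS f f0≡1 0       = cong (_* 1ℤ) f0≡1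
⊛-invPS f f0≡1 (suc n) = begin
  (f ⊛ invPS f) (suc n)     ≡⟨ ⊛-suc f (invPS f) n ⟩
  f 0 * - S′ + S            ≡⟨ cong₂ (λ x y → x * - y + S) f0≡1 S′≡S ⟩
  1ℤ * - S + S              ≡⟨ cancel S ⟩
  0ℤ                        ∎
  where
  open ≡-Reasoning
  S = sumTo (λ i → f (suc i) * invPS f (n ∸ i)) n
  S′ = foldr _ _+_ 0ℤ (zipWith _*_ (tabulate (λ t → f (suc (toℕ t)))) (invVec f n))
  S′≡S : S′ ≡ S
  S′≡S = foldr-zipWith-tabulate n (f ∘ suc) (invPS f) (invVec f n) (invVec-lookup f n)
  cancel : ∀ x → 1ℤ * - x + x ≡ 0ℤ
  cancel = solve 1 (λ x → con 1ℤ :* (:- x) :+ x := con 0ℤ) refl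

⊛-cancelˡ-upTo : ∀ f {g h} T → f 0 ≡ 1ℤ → (∀ i → i ℕ.≤ T → (f ⊛ g) i ≡ (f ⊛ h) i) →
                 ∀ i → i ℕ.≤ T → g i ≡ h i
⊛-cancelˡ-upTo f {g} {h} 0 f0≡1 eq 0 z≤n = begin
  g 0                ≡⟨ sym (ℤP.*-identityˡ (g 0)) ⟩
  1ℤ * g 0           ≡⟨ cong (_* g 0) (sym f0≡1) ⟩
  (f ⊛ g) 0          ≡⟨ eq 0 z≤n ⟩
  (f ⊛ h) 0          ≡⟨ cong (_* h 0) f0≡1 ⟩
  1ℤ * h 0           ≡⟨ ℤP.*-identityˡ (h 0) ⟩
  h 0                ∎
  where open ≡-Reasoning
⊛-cancelˡ-upTo f {g} {h} (suc T) f0≡1 eq = upTo1+T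
  where
  upToT : ∀ i → i ℕ.≤ T → g i ≡ h i
  upToT = ⊛-cancelˡ-upTo f {g} {h} T f0≡1 (λ i i≤T → eq i (ℕP.m≤n⇒m≤1+n i≤T))
  tail : (ℕ → ℤ) → ℤ
  tail k = sumTo (λ i → f (suc i) * k (T ∸ i)) T
  tails≡ : tail g ≡ tail h
  tails≡ = sumTo-cong T (λ i _ → cong (f (suc i) *_) (upToT (T ∸ i) (ℕP.m∸n≤m T i)))
  top : g (suc T) ≡ h (suc T)
  top = ∙-cancelʳ (tail g) (g (suc T)) (h (suc T)) (begin
    g (suc T) + tail g               ≡⟨ cong (_+ tail g) (sym (ℤP.*-identityˡ (g (suc T)))) ⟩
    1ℤ * g (suc T) + tail g          ≡⟨ cong (λ x → x * g (suc T) + tail g) (sym f0≡1) ⟩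
    f 0 * g (suc T) + tail g         ≡⟨ sym (⊛-suc f g T) ⟩
    (f ⊛ g) (suc T)                  ≡⟨ eq (suc T) ℕP.≤-refl ⟩
    (f ⊛ h) (suc T)                  ≡⟨ ⊛-suc f h T ⟩
    f 0 * h (suc T) + tail h         ≡⟨ cong₂ (λ x y → x * h (suc T) + y) f0≡1 (sym tails≡) ⟩
    1ℤ * h (suc T) + tail g          ≡⟨ cong (_+ tail g) (ℤP.*-identityˡ (h (suc T))) ⟩
    h (suc T) + tail g               ∎)
    where open ≡-Reasoning
  upTo1+T : ∀ i → i ℕ.≤ suc T → g i ≡ h i
  upTo1+T i i≤1+T with ℕP.m≤n⇒m<n∨m≡n i≤1+T
  ... | inj₁ (s≤s i≤T) = upToT i i≤T
  ... | inj₂ refl      = top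

-- Laurent series

≤⇒≡+∣-∣ : ∀ {b v} → b ℤ.≤ v → v ≡ b + + ∣ v - b ∣
≤⇒≡+∣-∣ {b} {v} b≤v =
  trans (v≡b+[v-b] v b) (cong (_+_ b) (sym (ℤP.0≤i⇒+∣i∣≡i (ℤP.i≤j⇒0≤j-i b≤v))))
  where
  v≡b+[v-b] : ∀ v b → v ≡ b + (v - b)
  v≡b+[v-b] = solve 2 (λ v b → v := b :+ (v :+ (:- b))) refl

+-pos-assoc : ∀ b d k → b + + (d ℕ.+ k) ≡ (b + + d) + + k
+-pos-assoc b d k = trans (cong (_+_ b) (ℤP.pos-+ d k)) (sym (ℤP.+-assoc b (+ d) (+ k)))

data Cutℤ (b : ℤ) : ℤ → Set where
  lo : ∀ {e} → e ℤ.< b → Cutℤ b e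
  hi : ∀ k → Cutℤ b (b + + k)

cutℤ : ∀ b e → Cutℤ b e
cutℤ b e with e ℤ.<? b
... | yes e<b = lo e<b
... | no  e≮b = subst (Cutℤ b) (sym (≤⇒≡+∣-∣ (ℤP.≮⇒≥ e≮b))) (hi ∣ e - b ∣)

coeff-lo : ∀ L {e} → e ℤ.< val L → coeff L e ≡ 0ℤ
coeff-lo L {e} e<v with e - val L in eq
... | -[1+ _ ] = refl
... | + k      = ⊥-elim (ℤP.<⇒≱ e<v (subst (val L ℤ.≤_) e≡v+k (ℤP.i≤i+j (val L) (+ k))))
  where
  e≡v+k : val L + + k ≡ e
  e≡v+k = trans (cong (_+_ (val L)) (sym eq)) (v+[e-v]≡e (val L) e)
    where
    v+[e-v]≡e : ∀ v e → v + (e - v) ≡ e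
    v+[e-v]≡e = solve 2 (λ v e → v :+ (e :+ (:- v)) := e) refl

coeff-hi : ∀ L k → coeff L (val L + + k) ≡ ser L k
coeff-hi L k = coeff-diff {val L + + k} (v+k-v≡k (val L) (+ k))
  where
  v+k-v≡k : ∀ v k → (v + k) - v ≡ k
  v+k-v≡k = solve 2 (λ v k → (v :+ k) :+ (:- v) := k) refl
  coeff-diff : ∀ {e} → e - val L ≡ + k → coeff L e ≡ ser L k
  coeff-diff {e} eq with e - val L
  coeff-diff refl | .(+ k) = refl

coeffsFrom : Laurent → ℤ → PS
coeffsFrom L b k = coeff L (b + + k)

coeffsFrom-shiftPS : ∀ L b d → val L ≡ b + + d → coeffsFrom L b ≗ shiftPS d (ser L)
coeffsFrom-shiftPS L b d v≡b+d i with cut d i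
... | lo i<d = trans (coeff-lo L (subst (b + + i ℤ.<_) (sym v≡b+d) (ℤP.+-monoʳ-< b (+<+ i<d))))
                     (sym (shiftPS-lo d (ser L) i<d))
... | hi k   = begin
  coeff L (b + + (d ℕ.+ k))  ≡⟨ cong (coeff L) (trans (+-pos-assoc b d k) (cong (_+ + k) (sym v≡b+d))) ⟩
  coeff L (val L + + k)      ≡⟨ coeff-hi L k ⟩
  ser L k                    ≡⟨ sym (shiftPS-hi d (ser L) k) ⟩
  shiftPS d (ser L) (d ℕ.+ k) ∎
  where open ≡-Reasoning

coeffsFrom-≤ : ∀ L {b} → b ℤ.≤ val L → coeffsFrom L b ≗ shiftPS ∣ val L - b ∣ (ser L)
coeffsFrom-≤ L {b} b≤v = coeffsFrom-shiftPS L b ∣ val L - b ∣ (≤⇒≡+∣-∣ b≤v)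

coeff-+L : ∀ X Y e → coeff (X +L Y) e ≡ coeff X e + coeff Y e
coeff-+L X Y e with cutℤ (val X ⊓ val Y) e
... | lo e<b = trans (coeff-lo (X +L Y) e<b)
                     (sym (cong₂ _+_ (coeff-lo X (ℤP.<-≤-trans e<b (ℤP.i⊓j≤i (val X) (val Y))))
                                     (coeff-lo Y (ℤP.<-≤-trans e<b (ℤP.i⊓j≤j (val X) (val Y))))))
... | hi i   = trans (coeff-hi (X +L Y) i)
                     (sym (cong₂ _+_ (coeffsFrom-≤ X (ℤP.i⊓j≤i (val X) (val Y)) i)
                                     (coeffsFrom-≤ Y (ℤP.i⊓j≤j (val X) (val Y)) i)))

coeffsFrom-*L : ∀ X Y {bX bY} → bX ℤ.≤ val X → bY ℤ.≤ val Y →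
                coeffsFrom (X *L Y) (bX + bY) ≗ coeffsFrom X bX ⊛ coeffsFrom Y bY
coeffsFrom-*L X Y {bX} {bY} bX≤ bY≤ i = begin
  coeffsFrom (X *L Y) (bX + bY) i             ≡⟨ coeffsFrom-shiftPS (X *L Y) (bX + bY) (dX ℕ.+ dY) val≡ i ⟩
  shiftPS (dX ℕ.+ dY) (ser X ⊛ ser Y) i       ≡⟨ sym (shiftPS-+ dX dY (ser X ⊛ ser Y) i) ⟩
  shiftPS dX (shiftPS dY (ser X ⊛ ser Y)) i
    ≡⟨ shiftPS-cong dX (λ k → sym (shiftPS-⊛ʳ dY (ser X) (ser Y) k)) i ⟩
  shiftPS dX (ser X ⊛ shiftPS dY (ser Y)) i   ≡⟨ sym (shiftPS-⊛ˡ dX (ser X) (shiftPS dY (ser Y)) i) ⟩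
  (shiftPS dX (ser X) ⊛ shiftPS dY (ser Y)) i
    ≡⟨ sym (trans (⊛-congˡ (coeffsFrom Y bY) (coeffsFrom-≤ X bX≤) i)
                  (⊛-congʳ (shiftPS dX (ser X)) (coeffsFrom-≤ Y bY≤) i)) ⟩
  (coeffsFrom X bX ⊛ coeffsFrom Y bY) i        ∎
  where
  open ≡-Reasoning
  dX = ∣ val X - bX ∣
  dY = ∣ val Y - bY ∣
  val≡ : val X + val Y ≡ (bX + bY) + + (dX ℕ.+ dY)
  val≡ = trans (cong₂ _+_ (≤⇒≡+∣-∣ bX≤) (≤⇒≡+∣-∣ bY≤))
               (trans (+-interchange bX (+ dX) bY (+ dY)) (cong (_+_ (bX + bY)) (sym (ℤP.pos-+ dX dY))))

-- Linearity of products and of the Atkin product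

infix 4 _≈_

_≈_ : Laurent → Laurent → Set
X ≈ Y = coeff X ≗ coeff Y

record LinComb (a : ℤ) (A : Laurent) (b : ℤ) (B : Laurent) (R : Laurent) : Set where
  constructor mkLinComb
  field coeff≡ : ∀ e → coeff R e ≡ a * coeff A e + b * coeff B e
open LinComb

≈⇒LinComb : ∀ {X Y} → X ≈ Y → LinComb 1ℤ Y 0ℤ Y X
≈⇒LinComb {Y = Y} X≈Y = mkLinComb λ e →
  trans (X≈Y e) (sym (trans (ℤP.+-identityʳ _) (ℤP.*-identityˡ (coeff Y e))))

LinComb⇒≈ : ∀ {X Y} → LinComb 1ℤ Y 0ℤ Y X → X ≈ Y
LinComb⇒≈ {Y = Y} lin e = trans (coeff≡ lin e) (trans (ℤP.+-identityʳ _) (ℤP.*-identityˡ (coeff Y e)))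

coeff-cong : ∀ {v v′ s s′} → v ≡ v′ → s ≗ s′ → ⟨ v , s ⟩ ≈ ⟨ v′ , s′ ⟩
coeff-cong {v} refl s≗s′ e with e - v
... | + k      = s≗s′ k
... | -[1+ _ ] = refl

*L-comm : ∀ X Y → X *L Y ≈ Y *L X
*L-comm X Y = coeff-cong (ℤP.+-comm (val X) (val Y)) (⊛-comm (ser X) (ser Y))

*L-linearˡ : ∀ {a A b B R} X → LinComb a A b B R → LinComb a (A *L X) b (B *L X) (R *L X)
*L-linearˡ {a} {A} {b} {B} {R} X R≡aA+bB = mkLinComb λ e → go e (cutℤ (β + val X) e)
  where
  β = val R ⊓ (val A ⊓ val B)
  β≤R : β ℤ.≤ val R
  β≤R = ℤP.i⊓j≤i (val R) (val A ⊓ val B)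
  β≤A : β ℤ.≤ val A
  β≤A = ℤP.≤-trans (ℤP.i⊓j≤j (val R) (val A ⊓ val B)) (ℤP.i⊓j≤i (val A) (val B))
  β≤B : β ℤ.≤ val B
  β≤B = ℤP.≤-trans (ℤP.i⊓j≤j (val R) (val A ⊓ val B)) (ℤP.i⊓j≤j (val A) (val B))
  go : ∀ e → Cutℤ (β + val X) e → coeff (R *L X) e ≡ a * coeff (A *L X) e + b * coeff (B *L X) e
  go e (lo e<β+x) = begin
    coeff (R *L X) e                             ≡⟨ coeff-lo (R *L X) (below β≤R) ⟩
    0ℤ                                           ≡⟨ sym (cong₂ _+_ (ℤP.*-zeroʳ a) (ℤP.*-zeroʳ b)) ⟩
    a * 0ℤ + b * 0ℤ
      ≡⟨ sym (cong₂ (λ y z → a * y + b * z) (coeff-lo (A *L X) (below β≤A)) (coeff-lo (B *L X) (below β≤B))) ⟩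
    a * coeff (A *L X) e + b * coeff (B *L X) e  ∎
    where
    open ≡-Reasoning
    below : ∀ {v} → β ℤ.≤ v → e ℤ.< v + val X
    below β≤v = ℤP.<-≤-trans e<β+x (ℤP.+-monoˡ-≤ (val X) β≤v)
  go .(β + val X + + i) (hi i) = begin
    coeffsFrom (R *L X) (β + val X) i
      ≡⟨ coeffsFrom-*L R X β≤R ℤP.≤-refl i ⟩
    (coeffsFrom R β ⊛ x) i
      ≡⟨ ⊛-congˡ x (λ k → coeff≡ R≡aA+bB (β + + k)) i ⟩
    ((λ k → a * coeffsFrom A β k + b * coeffsFrom B β k) ⊛ x) i
      ≡⟨ ⊛-linearˡ a b (coeffsFrom A β) (coeffsFrom B β) x i ⟩
    a * (coeffsFrom A β ⊛ x) i + b * (coeffsFrom B β ⊛ x) i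
      ≡⟨ sym (cong₂ (λ y z → a * y + b * z) (coeffsFrom-*L A X β≤A ℤP.≤-refl i)
                                            (coeffsFrom-*L B X β≤B ℤP.≤-refl i)) ⟩
    a * coeffsFrom (A *L X) (β + val X) i + b * coeffsFrom (B *L X) (β + val X) i ∎
    where
    open ≡-Reasoning
    x = coeffsFrom X (val X)

*L-linearʳ : ∀ {a A b B R} X → LinComb a A b B R → LinComb a (X *L A) b (X *L B) (X *L R)
*L-linearʳ {a} {A} {b} {B} {R} X lin = mkLinComb λ e → begin
  coeff (X *L R) e                              ≡⟨ *L-comm X R e ⟩
  coeff (R *L X) e                              ≡⟨ coeff≡ (*L-linearˡ X lin) e ⟩
  a * coeff (A *L X) e + b * coeff (B *L X) e
    ≡⟨ cong₂ (λ y z → a * y + b * z) (*L-comm A X e) (*L-comm B X e) ⟩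
  a * coeff (X *L A) e + b * coeff (X *L B) e   ∎
    where open ≡-Reasoning

*L-congˡ : ∀ {X X′} Y → X ≈ X′ → X *L Y ≈ X′ *L Y
*L-congˡ Y X≈X′ = LinComb⇒≈ (*L-linearˡ Y (≈⇒LinComb X≈X′))

*L-congʳ : ∀ X {Y Y′} → Y ≈ Y′ → X *L Y ≈ X *L Y′
*L-congʳ X Y≈Y′ = LinComb⇒≈ (*L-linearʳ X (≈⇒LinComb Y≈Y′))

*L-zeroʳ : ∀ X {A} → (∀ e → coeff A e ≡ 0ℤ) → ∀ e → coeff (X *L A) e ≡ 0ℤ
*L-zeroʳ X {A} A≡0 = coeff≡ (*L-linearʳ {0ℤ} {A} {0ℤ} {A} X (mkLinComb A≡0))

atkin-comm : ∀ X Y → atkin X Y ≡ atkin Y X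
atkin-comm X Y = *L-congˡ E2L (*L-comm X Y) 0ℤ

atkin-cong : ∀ {X X′ Y Y′} → X ≈ X′ → Y ≈ Y′ → atkin X Y ≡ atkin X′ Y′
atkin-cong {X} {X′} {Y} {Y′} X≈X′ Y≈Y′ =
  trans (*L-congˡ E2L (*L-congˡ Y X≈X′) 0ℤ) (*L-congˡ E2L (*L-congʳ X′ Y≈Y′) 0ℤ)

atkin-linearˡ : ∀ {a A b B R} Y → LinComb a A b B R → atkin R Y ≡ a * atkin A Y + b * atkin B Y
atkin-linearˡ Y lin = coeff≡ (*L-linearˡ E2L (*L-linearˡ Y lin)) 0ℤ

atkin-linearʳ : ∀ {a A b B R} Y → LinComb a A b B R → atkin Y R ≡ a * atkin Y A + b * atkin Y B
atkin-linearʳ {a} {A} {b} {B} {R} Y lin = begin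
  atkin Y R                          ≡⟨ atkin-comm Y R ⟩
  atkin R Y                          ≡⟨ atkin-linearˡ Y lin ⟩
  a * atkin A Y + b * atkin B Y      ≡⟨ cong₂ (λ y z → a * y + b * z) (atkin-comm A Y) (atkin-comm B Y) ⟩
  a * atkin Y A + b * atkin Y B      ∎
  where open ≡-Reasoning

-- Polynomials in j

coeff-constL : ∀ c e → coeff (constL c) e ≡ c * coeff (constL 1ℤ) e
coeff-constL c e with e - 0ℤ
... | -[1+ _ ] = sym (ℤP.*-zeroʳ c)
... | + 0      = sym (ℤP.*-identityʳ c)
... | + suc _  = sym (ℤP.*-zeroʳ c)

evalJ : List ℤ → Laurent
evalJ cs = evalPoly cs jL

evalJ-[] : ∀ e → coeff (evalJ []) e ≡ 0ℤ
evalJ-[] = coeff-constL 0ℤ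

evalJ-[]-unfold : evalJ [] ≈ constL 0ℤ +L jL *L evalJ []
evalJ-[]-unfold e = trans (evalJ-[] e)
  (sym (trans (coeff-+L (constL 0ℤ) (jL *L evalJ []) e) (cong₂ _+_ (evalJ-[] e) (*L-zeroʳ jL evalJ-[] e))))

-- The padding zeros keep every entry in the shape a * c + b * d that LinComb-∷ expects.
combine : ℤ → List ℤ → ℤ → List ℤ → List ℤ
combine a []       b []       = []
combine a (c ∷ cs) b []       = a * c + b * 0ℤ ∷ combine a cs b []
combine a []       b (d ∷ ds) = a * 0ℤ + b * d ∷ combine a [] b ds
combine a (c ∷ cs) b (d ∷ ds) = a * c + b * d ∷ combine a cs b ds

LinComb-∷ : ∀ {a A b B R} c d → LinComb a A b B R →
  LinComb a (constL c +L jL *L A) b (constL d +L jL *L B) (constL (a * c + b * d) +L jL *L R)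
LinComb-∷ {a} {A} {b} {B} {R} c d lin = mkLinComb λ e → begin
  coeff (constL (a * c + b * d) +L jL *L R) e
    ≡⟨ coeff-+L (constL (a * c + b * d)) (jL *L R) e ⟩
  coeff (constL (a * c + b * d)) e + coeff (jL *L R) e
    ≡⟨ cong₂ _+_ (coeff-constL (a * c + b * d) e) (coeff≡ (*L-linearʳ jL lin) e) ⟩
  (a * c + b * d) * δ e + (a * coeff (jL *L A) e + b * coeff (jL *L B) e)
    ≡⟨ regroup a b c d (δ e) (coeff (jL *L A) e) (coeff (jL *L B) e) ⟩
  a * (c * δ e + coeff (jL *L A) e) + b * (d * δ e + coeff (jL *L B) e)
    ≡⟨ sym (cong₂ (λ x y → a * x + b * y) (unfold c A e) (unfold d B e)) ⟩
  a * coeff (constL c +L jL *L A) e + b * coeff (constL d +L jL *L B) e ∎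
  where
  open ≡-Reasoning
  δ : ℤ → ℤ
  δ = coeff (constL 1ℤ)
  unfold : ∀ x X e → coeff (constL x +L jL *L X) e ≡ x * δ e + coeff (jL *L X) e
  unfold x X e = trans (coeff-+L (constL x) (jL *L X) e) (cong (_+ coeff (jL *L X) e) (coeff-constL x e))
  regroup : ∀ a b c d t x y → (a * c + b * d) * t + (a * x + b * y) ≡ a * (c * t + x) + b * (d * t + y)
  regroup = solve 7 (λ a b c d t x y → (a :* c :+ b :* d) :* t :+ (a :* x :+ b :* y)
                                        := a :* (c :* t :+ x) :+ b :* (d :* t :+ y)) refl

evalJ-combine : ∀ a cs b ds → LinComb a (evalJ cs) b (evalJ ds) (evalJ (combine a cs b ds))
evalJ-combine a []       b []       = mkLinComb λ e →
  trans (evalJ-[] e) (sym (trans (cong₂ (λ x y → a * x + b * y) (evalJ-[] e) (evalJ-[] e))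
                                 (cong₂ _+_ (ℤP.*-zeroʳ a) (ℤP.*-zeroʳ b))))
evalJ-combine a (c ∷ cs) b []       = mkLinComb λ e →
  trans (coeff≡ (LinComb-∷ c 0ℤ (evalJ-combine a cs b [])) e)
        (cong (λ x → a * coeff (evalJ (c ∷ cs)) e + b * x) (sym (evalJ-[]-unfold e)))
evalJ-combine a []       b (d ∷ ds) = mkLinComb λ e →
  trans (coeff≡ (LinComb-∷ 0ℤ d (evalJ-combine a [] b ds)) e)
        (cong (λ x → a * x + b * coeff (evalJ (d ∷ ds)) e) (sym (evalJ-[]-unfold e)))
evalJ-combine a (c ∷ cs) b (d ∷ ds) = LinComb-∷ c d (evalJ-combine a cs b ds)

sumPoly : (ℕ → ℤ) → (ℕ → List ℤ) → ℕ → List ℤ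
sumPoly c p 0       = combine (c 0) (p 0) 0ℤ []
sumPoly c p (suc K) = combine 1ℤ (sumPoly c p K) (c (suc K)) (p (suc K))

sumPoly-linear : (Φ : Laurent → ℤ) →
  (∀ {a A b B R} → LinComb a A b B R → Φ R ≡ a * Φ A + b * Φ B) →
  ∀ c p K → Φ (evalJ (sumPoly c p K)) ≡ sumTo (λ n → c n * Φ (evalJ (p n))) K
sumPoly-linear Φ linear c p 0       =
  trans (linear (evalJ-combine (c 0) (p 0) 0ℤ [])) (ℤP.+-identityʳ (c 0 * Φ (evalJ (p 0))))
sumPoly-linear Φ linear c p (suc K) =
  trans (linear (evalJ-combine 1ℤ (sumPoly c p K) (c (suc K)) (p (suc K))))
        (cong (_+ c (suc K) * Φ (evalJ (p (suc K))))
              (trans (ℤP.*-identityˡ _) (sumPoly-linear Φ linear c p K)))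

atkin-sumPoly : ∀ (g h : PS) (p : ℕ → List ℤ) N L →
  atkin (evalJ (sumPoly (λ n → g (N ∸ n)) p N)) (evalJ (sumPoly (λ ℓ → h (L ∸ ℓ)) p L))
    ≡ mulPQ g h (λ n ℓ → atkin (evalJ (p n)) (evalJ (p ℓ))) N L
atkin-sumPoly g h p N L = begin
  atkin (evalJ (sumPoly (λ n → g (N ∸ n)) p N)) Y
    ≡⟨ sumPoly-linear (λ X → atkin X Y) (atkin-linearˡ Y) (λ n → g (N ∸ n)) p N ⟩
  sumTo (λ n → g (N ∸ n) * atkin (evalJ (p n)) Y) N
    ≡⟨ sumTo-cong N (λ n _ → cong (g (N ∸ n) *_)
         (sumPoly-linear (atkin (evalJ (p n))) (atkin-linearʳ (evalJ (p n))) (λ ℓ → h (L ∸ ℓ)) p L)) ⟩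
  sumTo (λ n → g (N ∸ n) * sumTo (λ ℓ → h (L ∸ ℓ) * atkin (evalJ (p n)) (evalJ (p ℓ))) L) N
    ≡⟨ sumTo-cong N (λ n _ → trans (*-distribˡ-sumTo (g (N ∸ n)) _ L)
                                   (sumTo-cong L (λ ℓ _ → reorder (g (N ∸ n)) (h (L ∸ ℓ)) _))) ⟩
  mulPQ g h (λ n ℓ → atkin (evalJ (p n)) (evalJ (p ℓ))) N L ∎
  where
  open ≡-Reasoning
  Y = evalJ (sumPoly (λ ℓ → h (L ∸ ℓ)) p L)
  reorder : ∀ x y a → x * (y * a) ≡ a * x * y
  reorder = solve 3 (λ x y a → x :* (y :* a) := a :* x :* y) refl

-- Cancellation of units and uniqueness

*L-cancelˡ-upTo : ∀ X {A B} t → ser X 0 ≡ 1ℤ →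
  (∀ e → e ℤ.≤ val X + t → coeff (X *L A) e ≡ coeff (X *L B) e) →
  ∀ e → e ℤ.≤ t → coeff A e ≡ coeff B e
*L-cancelˡ-upTo X {A} {B} t X₀≡1 agree e e≤t = go e e≤t (cutℤ β e)
  where
  β = val A ⊓ val B
  β≤A = ℤP.i⊓j≤i (val A) (val B)
  β≤B = ℤP.i⊓j≤j (val A) (val B)
  x = coeffsFrom X (val X)
  go : ∀ e → e ℤ.≤ t → Cutℤ β e → coeff A e ≡ coeff B e
  go e _ (lo e<β) =
    trans (coeff-lo A (ℤP.<-≤-trans e<β β≤A)) (sym (coeff-lo B (ℤP.<-≤-trans e<β β≤B)))
  go .(β + + i) β+i≤t (hi i) =
    ⊛-cancelˡ-upTo x {coeffsFrom A β} {coeffsFrom B β} i (trans (coeff-hi X 0) X₀≡1) agree-from-β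
                   i ℕP.≤-refl
    where
    in-range : ∀ k → k ℕ.≤ i → val X + β + + k ℤ.≤ val X + t
    in-range k k≤i = subst (ℤ._≤ val X + t) (sym (ℤP.+-assoc (val X) β (+ k)))
      (ℤP.+-monoʳ-≤ (val X) (ℤP.≤-trans (ℤP.+-monoʳ-≤ β (ℤ.+≤+ k≤i)) β+i≤t))
    agree-from-β : ∀ k → k ℕ.≤ i → (x ⊛ coeffsFrom A β) k ≡ (x ⊛ coeffsFrom B β) k
    agree-from-β k k≤i = trans (sym (coeffsFrom-*L X A ℤP.≤-refl β≤A k))
      (trans (agree _ (in-range k k≤i)) (coeffsFrom-*L X B ℤP.≤-refl β≤B k))

evalJ-zero : ∀ cs → (∀ e → e ℤ.≤ 0ℤ → coeff (evalJ cs) e ≡ 0ℤ) →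
             ∀ e → coeff (evalJ cs) e ≡ 0ℤ
evalJ-zero []       _        = evalJ-[]
evalJ-zero (c ∷ cs) low≡0 e = begin
  coeff (evalJ (c ∷ cs)) e                ≡⟨ split e ⟩
  coeff (constL c) e + coeff (jL *L Q) e
    ≡⟨ cong₂ _+_ (trans (coeff-constL c e) (cong (_* coeff (constL 1ℤ) e) c≡0)) (jQ≡0 e) ⟩
  0ℤ                                      ∎
  where
  open ≡-Reasoning
  Q = evalJ cs
  split : ∀ e → coeff (evalJ (c ∷ cs)) e ≡ coeff (constL c) e + coeff (jL *L Q) e
  split = coeff-+L (constL c) (jL *L Q)
  jQ<0 : ∀ e → e ℤ.< 0ℤ → coeff (jL *L Q) e ≡ 0ℤ
  jQ<0 e e<0 = begin
    coeff (jL *L Q) e                       ≡⟨ sym (ℤP.+-identityˡ _) ⟩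
    0ℤ + coeff (jL *L Q) e                  ≡⟨ cong (_+ coeff (jL *L Q) e) (sym (coeff-lo (constL c) e<0)) ⟩
    coeff (constL c) e + coeff (jL *L Q) e  ≡⟨ sym (split e) ⟩
    coeff (evalJ (c ∷ cs)) e                ≡⟨ low≡0 e (ℤP.<⇒≤ e<0) ⟩
    0ℤ                                      ∎
  -- The leading coefficient of j is 1 by computation, so j cancels from the terms of order ≤ -1.
  Q≤0 : ∀ e → e ℤ.≤ 0ℤ → coeff Q e ≡ coeff (evalJ []) e
  Q≤0 = *L-cancelˡ-upTo jL 0ℤ refl
          (λ e e≤-1 → trans (jQ<0 e (ℤP.≤-<-trans e≤-1 ℤ.-<+)) (sym (*L-zeroʳ jL evalJ-[] e)))
  jQ≡0 : ∀ e → coeff (jL *L Q) e ≡ 0ℤ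
  jQ≡0 = *L-zeroʳ jL (evalJ-zero cs (λ e e≤0 → trans (Q≤0 e e≤0) (evalJ-[] e)))
  c≡0 : c ≡ 0ℤ
  c≡0 = begin
    c                                         ≡⟨ sym (ℤP.+-identityʳ c) ⟩
    c + 0ℤ                                    ≡⟨ cong (_+_ c) (sym (jQ≡0 0ℤ)) ⟩
    coeff (constL c) 0ℤ + coeff (jL *L Q) 0ℤ  ≡⟨ sym (split 0ℤ) ⟩
    coeff (evalJ (c ∷ cs)) 0ℤ                 ≡⟨ low≡0 0ℤ ℤP.≤-refl ⟩
    0ℤ                                        ∎

-- Generalized Faber polynomials

^L-val0 : ∀ s n → ⟨ 0ℤ , s ⟩ ^L n ≡ ⟨ 0ℤ , s ^ₛ n ⟩
^L-val0 s 0       = refl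
^L-val0 s (suc n) = cong (⟨ 0ℤ , s ⟩ *L_) (^L-val0 s n)

baseForm≡ : ∀ m δ ε → baseForm m δ ε ≡ ⟨ m , unitFactor m δ ε ⟩
baseForm≡ m δ ε =
  trans (cong₂ (λ X Y → X *L Y *L ΔL^ m) (^L-val0 E4 (toℕ δ)) (^L-val0 E6 (toℕ ε)))
        (cong (λ v → ⟨ v , unitFactor m δ ε ⟩) (ℤP.+-identityˡ m))

^ₛ-head : ∀ s n → s 0 ≡ 1ℤ → (s ^ₛ n) 0 ≡ 1ℤ
^ₛ-head s 0       _    = refl
^ₛ-head s (suc n) s₀≡1 = cong₂ _*_ s₀≡1 (^ₛ-head s n s₀≡1)

unitFactor-head : ∀ m δ ε → unitFactor m δ ε 0 ≡ 1ℤ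
unitFactor-head m δ ε =
  cong₂ _*_ (cong₂ _*_ (^ₛ-head E4 (toℕ δ) refl) (^ₛ-head E6 (toℕ ε) refl)) (Δ/q^-head m)
  where
  -- Δ/q has constant term (E4³ - E6²)₁ / 1728 = (720 + 1008) / 1728 = 1, which refl evaluates.
  Δ/q^-head : ∀ m → (Δ/q ^ᶻ m) 0 ≡ 1ℤ
  Δ/q^-head (+ n)    = ^ₛ-head Δ/q n refl
  Δ/q^-head -[1+ n ] = ^ₛ-head (invPS Δ/q) (suc n) refl

unitFactor₀-⊛-one : unitFactor 0ℤ zero zero ⊛ onePS ≗ onePS
unitFactor₀-⊛-one i =
  trans (⊛-identityʳ (unitFactor 0ℤ zero zero) i)
        (trans (⊛-identityʳ (onePS ⊛ onePS) i) (⊛-identityˡ onePS i))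

monomial-self : ∀ c → coeff ⟨ c , onePS ⟩ c ≡ 1ℤ
monomial-self c =
  trans (cong (coeff ⟨ c , onePS ⟩) (sym (ℤP.+-identityʳ c))) (coeff-hi ⟨ c , onePS ⟩ 0)

monomial-other : ∀ {c e} → e ≢ c → coeff ⟨ c , onePS ⟩ e ≡ 0ℤ
monomial-other {c} {e} e≢c with cutℤ c e
... | lo e<c     = coeff-lo ⟨ c , onePS ⟩ e<c
... | hi 0       = ⊥-elim (e≢c (ℤP.+-identityʳ c))
... | hi (suc k) = coeff-hi ⟨ c , onePS ⟩ (suc k)

coeff-monomial : ∀ c e → coeff ⟨ c , onePS ⟩ e ≡ (if does (e ℤ.≟ c) then 1ℤ else 0ℤ)
coeff-monomial c e with e ℤ.≟ c
... | yes refl = monomial-self c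
... | no  e≢c  = monomial-other e≢c

faber-principalPart : ∀ m δ ε {N P} (w : PS) → unitFactor m δ ε ⊛ w ≗ onePS → IsFaber m δ ε N P →
  ∀ e → e ℤ.≤ 0ℤ → coeff (atJ P) e ≡ coeff ⟨ - + N , w ⟩ e
faber-principalPart m δ ε {N} {P} w Uw≗1 isFaber =
  *L-cancelˡ-upTo H 0ℤ (unitFactor-head m δ ε) agree
  where
  -- H · q^(-N) w is exactly the monomial q^(m-N) that the Faber condition prescribes up to q^m.
  H = ⟨ m , unitFactor m δ ε ⟩
  agree : ∀ e → e ℤ.≤ m + 0ℤ → coeff (H *L atJ P) e ≡ coeff (H *L ⟨ - + N , w ⟩) e
  agree e e≤m = begin
    coeff (H *L atJ P) e                      ≡⟨ cong (λ B → coeff (B *L atJ P) e) (sym (baseForm≡ m δ ε)) ⟩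
    coeff (baseForm m δ ε *L atJ P) e         ≡⟨ isFaber e (subst (e ℤ.≤_) (ℤP.+-identityʳ m) e≤m) ⟩
    (if does (e ℤ.≟ m - + N) then 1ℤ else 0ℤ) ≡⟨ sym (coeff-monomial (m - + N) e) ⟩
    coeff ⟨ m - + N , onePS ⟩ e               ≡⟨ sym (coeff-cong refl Uw≗1 e) ⟩
    coeff (H *L ⟨ - + N , w ⟩) e              ∎
    where open ≡-Reasoning

≤0⇒≡-∣∣ : ∀ {e} → e ℤ.≤ 0ℤ → e ≡ - + ∣ e ∣
≤0⇒≡-∣∣ {+ 0}       _          = refl
≤0⇒≡-∣∣ {+ suc _}   (ℤ.+≤+ ())
≤0⇒≡-∣∣ { -[1+ _ ]} _          = refl

coeff-at-neg : ∀ s {n k} → k ℕ.≤ n → coeff ⟨ - + n , s ⟩ (- + k) ≡ s (n ∸ k)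
coeff-at-neg s {n} {k} k≤n =
  trans (cong (coeff ⟨ - + n , s ⟩)
              (subst (λ x → - + k ≡ - + x + + (n ∸ k)) (ℕP.m+[n∸m]≡n k≤n) offset))
        (coeff-hi ⟨ - + n , s ⟩ (n ∸ k))
  where
  -x≡-[x+y]+y : ∀ x y → - x ≡ - (x + y) + y
  -x≡-[x+y]+y = solve 2 (λ x y → :- x := :- (x :+ y) :+ y) refl
  offset : - + k ≡ - + (k ℕ.+ (n ∸ k)) + + (n ∸ k)
  offset = trans (-x≡-[x+y]+y (+ k) (+ (n ∸ k)))
                 (cong (λ x → - x + + (n ∸ k)) (sym (ℤP.pos-+ k (n ∸ k))))

principalPart-sum : ∀ (u : PS) N e → e ℤ.≤ 0ℤ →
  coeff ⟨ - + N , u ⟩ e ≡ sumTo (λ n → u (N ∸ n) * coeff ⟨ - + n , onePS ⟩ e) N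
principalPart-sum u N e e≤0 =
  subst (λ e → coeff ⟨ - + N , u ⟩ e ≡ sumTo (λ n → u (N ∸ n) * coeff ⟨ - + n , onePS ⟩ e) N)
        (sym (≤0⇒≡-∣∣ e≤0)) (at ∣ e ∣)
  where
  ind : ℕ → ℕ → ℤ
  ind k n = coeff ⟨ - + n , onePS ⟩ (- + k)
  ind-other : ∀ k n → n ≢ k → ind k n ≡ 0ℤ
  ind-other k n n≢k = monomial-other (λ -k≡-n → n≢k (sym (ℤP.+-injective (ℤP.neg-injective -k≡-n))))
  at : ∀ k → coeff ⟨ - + N , u ⟩ (- + k) ≡ sumTo (λ n → u (N ∸ n) * ind k n) N
  at k with k ℕ.≤? N
  ... | yes k≤N =
    trans (coeff-at-neg u k≤N)
          (sym (sumTo-select (λ n → u (N ∸ n)) (ind k) (monomial-self (- + k)) (ind-other k) N k≤N))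
  ... | no  k≰N =
    trans (coeff-lo ⟨ - + N , u ⟩ (ℤP.neg-mono-< (+<+ (ℕP.≰⇒> k≰N))))
          (sym (sumTo-zero N (λ n n≤N → trans (cong (u (N ∸ n) *_) (ind-other k n (λ { refl → k≰N n≤N })))
                                              (ℤP.*-zeroʳ (u (N ∸ n))))))

faber-expansion : ∀ (u : PS) N (P : Monic N) (F₀ : (n : ℕ) → Monic n) →
  (∀ e → e ℤ.≤ 0ℤ → coeff (atJ P) e ≡ coeff ⟨ - + N , u ⟩ e) →
  (∀ n e → e ℤ.≤ 0ℤ → coeff (atJ (F₀ n)) e ≡ coeff ⟨ - + n , onePS ⟩ e) →
  atJ P ≈ evalJ (sumPoly (λ n → u (N ∸ n)) (monicCoeffs ∘ F₀) N)
faber-expansion u N P F₀ P≡ F₀≡ e = difference≡0 (trans (sym (D≡P-C e)) (evalJ-zero D D≤0 e))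
  where
  C = sumPoly (λ n → u (N ∸ n)) (monicCoeffs ∘ F₀) N
  D = combine 1ℤ (monicCoeffs P) (- 1ℤ) C
  D≡P-C : ∀ e → coeff (evalJ D) e ≡ 1ℤ * coeff (atJ P) e + - 1ℤ * coeff (evalJ C) e
  D≡P-C = coeff≡ (evalJ-combine 1ℤ (monicCoeffs P) (- 1ℤ) C)
  difference≡0 : ∀ {x y} → 1ℤ * x + - 1ℤ * y ≡ 0ℤ → x ≡ y
  difference≡0 {x} {y} eq = trans (x≡[x-y]+y x y) (trans (cong (_+ y) eq) (ℤP.+-identityˡ y))
    where
    x≡[x-y]+y : ∀ x y → x ≡ (1ℤ * x + - 1ℤ * y) + y
    x≡[x-y]+y = solve 2 (λ x y → x := (con 1ℤ :* x :+ con (- 1ℤ) :* y) :+ y) refl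
  D≤0 : ∀ e → e ℤ.≤ 0ℤ → coeff (evalJ D) e ≡ 0ℤ
  D≤0 e e≤0 = begin
    coeff (evalJ D) e
      ≡⟨ D≡P-C e ⟩
    1ℤ * coeff (atJ P) e + - 1ℤ * coeff (evalJ C) e
      ≡⟨ cong (λ y → 1ℤ * coeff (atJ P) e + - 1ℤ * y)
              (sumPoly-linear (λ X → coeff X e) (λ lin → coeff≡ lin e) _ _ N) ⟩
    1ℤ * coeff (atJ P) e + - 1ℤ * sumTo (λ n → u (N ∸ n) * coeff (atJ (F₀ n)) e) N
      ≡⟨ cong₂ (λ x y → 1ℤ * x + - 1ℤ * y)
               (P≡ e e≤0) (sumTo-cong N (λ n _ → cong (u (N ∸ n) *_) (F₀≡ n e e≤0))) ⟩
    1ℤ * coeff ⟨ - + N , u ⟩ e + - 1ℤ * sumTo (λ n → u (N ∸ n) * coeff ⟨ - + n , onePS ⟩ e) N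
      ≡⟨ cong (λ y → 1ℤ * coeff ⟨ - + N , u ⟩ e + - 1ℤ * y) (sym (principalPart-sum u N e e≤0)) ⟩
    1ℤ * coeff ⟨ - + N , u ⟩ e + - 1ℤ * coeff ⟨ - + N , u ⟩ e
      ≡⟨ x-x≡0 (coeff ⟨ - + N , u ⟩ e) ⟩
    0ℤ ∎
    where
    open ≡-Reasoning
    x-x≡0 : ∀ x → 1ℤ * x + - 1ℤ * x ≡ 0ℤ
    x-x≡0 = solve 1 (λ x → con 1ℤ :* x :+ con (- 1ℤ) :* x := con 0ℤ) refl

corollary5p6 :
    (m : ℤ) (δ : Fin 3) (ε : Fin 2) →
    (F : (n : ℕ) → Monic n) → (∀ n → IsFaber m δ ε n (F n)) →
    (F₀ : (n : ℕ) → Monic n) → (∀ n → IsFaber 0ℤ zero zero n (F₀ n)) →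
    ∀ (N L : ℕ) →
      atkin (atJ (F N)) (atJ (F L))
        ≡ mulPQ (invPS (unitFactor m δ ε)) (invPS (unitFactor m δ ε))
                (λ n ℓ → atkin (atJ (F₀ n)) (atJ (F₀ ℓ))) N L
corollary5p6 m δ ε F isFaber F₀ isFaber₀ N L =
  trans (atkin-cong (expansion N) (expansion L)) (atkin-sumPoly u u (monicCoeffs ∘ F₀) N L)
  where
  u = invPS (unitFactor m δ ε)
  expansion : ∀ K → atJ (F K) ≈ evalJ (sumPoly (λ n → u (K ∸ n)) (monicCoeffs ∘ F₀) K)
  expansion K = faber-expansion u K (F K) F₀
    (faber-principalPart m δ ε u (⊛-invPS (unitFactor m δ ε) (unitFactor-head m δ ε)) (isFaber K))
    (λ n → faber-principalPart 0ℤ zero zero onePS unitFactor₀-⊛-one (isFaber₀ n))
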